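{- For every integer $n\ge 1$, \[ \ell_q\big(\{1,2,\ldots,n\}\big)=\frac12\left(\frac{n(n+1)}{2}+\left\lceil\frac n2\right\rceil\right). \]
   Context: All graphs are finite and simple. The degree set of a graph is the set of distinct degrees of its vertices. For a finite nonempty set $\mathscr D$ of positive integers, $\ell_q(\mathscr D)$ denotes the least number of edges of a simple graph whose degree set is exactly $\mathscr D$. -}

module Defs where

open import Data.Nat using (ℕ; zero; suc; _+_; _*_; _≤_; _<ᵇ_; _/_)
open import Data.Bool using (Bool; true; false; if_then_else_)
open import Data.Fin using (Fin; toℕ)
open import Data.List using (List; map; allFin)
open import Data.Nat.ListAction using (sum)
open import Data.Product using (Σ; ∃; _×_)
open import Relation.Binary.PropositionalEquality using (_≡_)

record SimpleGraph : Set where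
  field
    order : ℕ
    adj   : Fin order → Fin order → Bool
    sym   : ∀ i j → adj i j ≡ adj j i
    irrefl : ∀ i → adj i i ≡ false

open SimpleGraph public

b2n : Bool → ℕ
b2n true  = 1
b2n false = 0

degree : (G : SimpleGraph) → Fin (order G) → ℕ
degree G i = sum (map (λ j → b2n (adj G i j)) (allFin (order G)))

edgeCount : SimpleGraph → ℕ
edgeCount G =
  sum (map (λ i → sum (map (λ j → b2n (toℕ i <ᵇ toℕ j) * b2n (adj G i j))
                             (allFin (order G))))
           (allFin (order G)))

HasDegreeSet1to : ℕ → SimpleGraph → Set
HasDegreeSet1to n G =
  (∀ i → (1 ≤ degree G i) × (degree G i ≤ n)) ×
  (∀ d → 1 ≤ d → d ≤ n → ∃ λ i → degree G i ≡ d)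

IsLq1to : ℕ → ℕ → Set
IsLq1to n m =
  (Σ SimpleGraph λ G → HasDegreeSet1to n G × (edgeCount G ≡ m)) ×
  (∀ (G : SimpleGraph) → HasDegreeSet1to n G → m ≤ edgeCount G)

ceilHalf : ℕ → ℕ
ceilHalf n = (n + 1) / 2

-- Write n = m + k with m = ⌊n/2⌋ and k = ⌈n/2⌉. A graph with degree set {1, …, n} has k vertices of
-- the degrees m + 1, …, n; their degree sum is k(m + 1) + k(k − 1)/2, at most k(k − 1) of which comes
-- from edges inside this set, while edges leaving it are paid for by the other degrees. Hence
-- 2|E| ≥ 2k(m + 1). Conversely, take branch vertices 0, …, n − 1 with x ~ y iff x ≠ y and
-- x + y ≥ n − 1, and hang a pendant vertex on every x ≥ m: x has x + 1 branch neighbours except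
-- when 2x ≥ n − 1, which happens exactly when x ≥ m and the pendant vertex makes up for it. So the
-- degrees are x + 1 and k ones, and there are exactly k(m + 1) = (n(n + 1)/2 + ⌈n/2⌉)/2 edges.

module Submission where

open import Defs hiding (sym)
open import Algebra.Properties.Semiring.Sum as ∑ using ()
open import Data.Bool using (true; false; not; _∧_)
open import Data.Fin using (Fin; zero; suc; toℕ; splitAt; _↑ˡ_; fromℕ<)
open import Data.Fin.Properties using (toℕ<n; toℕ-injective; toℕ-fromℕ<; splitAt-↑ˡ)
  renaming (_≟_ to _≟ᶠ_)
import Data.Fin.Properties as Finₚ using (suc-injective)
open import Data.List using (map; tabulate; allFin)
import Data.Nat.ListAction as List using (sum)
open import Data.Nat
open import Data.Nat.Properties
open import Data.Nat.DivMod using (m*n/n≡m; +-distrib-/-∣ˡ)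
open import Data.Nat.Divisibility using (n∣m*n)
open import Data.Nat.Tactic.RingSolver using (solve-∀)
open import Data.Product using (∃; ∃₂; _×_; _,_; proj₁; proj₂)
open import Data.Sum using (_⊎_; inj₁; inj₂; map₁)
open import Data.Empty using (⊥)
open import Function using (_∘_; _⇔_; mk⇔; Injective)
open import Relation.Binary.Definitions using (Decidable; Symmetric; tri<; tri≈; tri>)
open import Relation.Binary.PropositionalEquality
open import Relation.Nullary using (Dec; does; yes; no; ¬_; ¬?; _×-dec_; contradiction)
open import Relation.Nullary.Decidable using (dec-true; dec-false; does-⇔)

open ∑ +-*-semiring using (sum; sum-syntax; sum-cong-≗; ∑-distrib-+; ∑-comm; *-distribˡ-sum; *-distribʳ-sum; sum-replicate-zero)

𝟙[_] : ∀ {P : Set} → Dec P → ℕ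
𝟙[ P? ] = b2n (does P?)

𝟙-yes : ∀ {P : Set} (P? : Dec P) → P → 𝟙[ P? ] ≡ 1
𝟙-yes P? p = cong b2n (dec-true P? p)

𝟙-no : ∀ {P : Set} (P? : Dec P) → ¬ P → 𝟙[ P? ] ≡ 0
𝟙-no P? ¬p = cong b2n (dec-false P? ¬p)

𝟙-≤?-suc : ∀ m n → 𝟙[ suc m ≤? suc n ] ≡ 𝟙[ m ≤? n ]
𝟙-≤?-suc zero    n = refl
𝟙-≤?-suc (suc m) n = refl

b2n≤1 : ∀ b → b2n b ≤ 1
b2n≤1 true  = ≤-refl
b2n≤1 false = z≤n

sum-map-tabulate : ∀ {A : Set} {n} (g : Fin n → A) (f : A → ℕ) →
                   List.sum (map f (tabulate g)) ≡ ∑[ i < n ] f (g i)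
sum-map-tabulate {n = zero}  g f = refl
sum-map-tabulate {n = suc n} g f = cong (f (g zero) +_) (sum-map-tabulate (g ∘ suc) f)

sum-map-allFin : ∀ n (f : Fin n → ℕ) → List.sum (map f (allFin n)) ≡ ∑[ i < n ] f i
sum-map-allFin n f = sum-map-tabulate (λ i → i) f

∑-const : ∀ n c → ∑[ i < n ] c ≡ n * c
∑-const zero    c = refl
∑-const (suc n) c = cong (c +_) (∑-const n c)

∑-mono-≤ : ∀ {n} {f g : Fin n → ℕ} → (∀ i → f i ≤ g i) → sum f ≤ sum g
∑-mono-≤ {zero}  f≤g = z≤n
∑-mono-≤ {suc n} f≤g = +-mono-≤ (f≤g zero) (∑-mono-≤ (f≤g ∘ suc))

∑-suc : ∀ {n} (f : Fin n → ℕ) → ∑[ i < n ] suc (f i) ≡ n + sum f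
∑-suc {n} f = trans (∑-distrib-+ (λ _ → 1) f) (cong (_+ sum f) (trans (∑-const n 1) (*-identityʳ n)))

∑-splitAt : ∀ m n (f : Fin m ⊎ Fin n → ℕ) →
            ∑[ v < m + n ] f (splitAt m v) ≡ ∑[ i < m ] f (inj₁ i) + ∑[ j < n ] f (inj₂ j)
∑-splitAt zero    n f = refl
∑-splitAt (suc m) n f = trans (cong (f (inj₁ zero) +_) (∑-splitAt m n (f ∘ map₁ suc)))
                              (sym (+-assoc (f (inj₁ zero)) _ _))

∑-pick : ∀ {n} (w : Fin n) (f : Fin n → ℕ) → ∑[ u < n ] (𝟙[ w ≟ᶠ u ] * f u) ≡ f w
∑-pick {suc n} zero    f = trans (cong₂ _+_ (+-identityʳ (f zero)) (sum-replicate-zero n)) (+-identityʳ (f zero))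
∑-pick {suc n} (suc w) f = ∑-pick w (f ∘ suc)

∑-except : ∀ {n} {Q : Fin n → Set} (x : Fin n) (Q? : ∀ y → Dec (Q y)) →
           ∑[ y < n ] 𝟙[ ¬? (x ≟ᶠ y) ×-dec Q? y ] + 𝟙[ Q? x ] ≡ ∑[ y < n ] 𝟙[ Q? y ]
∑-except {n} x Q? = begin
  ∑[ y < n ] 𝟙[ ¬? (x ≟ᶠ y) ×-dec Q? y ] + 𝟙[ Q? x ]
    ≡⟨ cong (∑[ y < n ] 𝟙[ ¬? (x ≟ᶠ y) ×-dec Q? y ] +_) (sym (∑-pick x (λ y → 𝟙[ Q? y ]))) ⟩
  ∑[ y < n ] 𝟙[ ¬? (x ≟ᶠ y) ×-dec Q? y ] + ∑[ y < n ] (𝟙[ x ≟ᶠ y ] * 𝟙[ Q? y ])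
    ≡⟨ sym (∑-distrib-+ (λ y → 𝟙[ ¬? (x ≟ᶠ y) ×-dec Q? y ]) (λ y → 𝟙[ x ≟ᶠ y ] * 𝟙[ Q? y ])) ⟩
  ∑[ y < n ] (𝟙[ ¬? (x ≟ᶠ y) ×-dec Q? y ] + 𝟙[ x ≟ᶠ y ] * 𝟙[ Q? y ])
    ≡⟨ sum-cong-≗ {n} (λ y → split (does (x ≟ᶠ y)) (does (Q? y))) ⟩
  ∑[ y < n ] 𝟙[ Q? y ] ∎
  where
  open ≡-Reasoning
  split : ∀ a b → b2n (not a ∧ b) + b2n a * b2n b ≡ b2n b
  split true  true  = refl
  split true  false = refl
  split false true  = refl
  split false false = refl

∑-count-≥ : ∀ n c → ∑[ y < n ] 𝟙[ c ≤? toℕ y ] ≡ n ∸ c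
∑-count-≥ zero    zero    = refl
∑-count-≥ zero    (suc c) = refl
∑-count-≥ (suc n) zero    = cong suc (trans (∑-const n 1) (*-identityʳ n))
∑-count-≥ (suc n) (suc c) = trans (sum-cong-≗ {n} (λ y → 𝟙-≤?-suc c (toℕ y))) (∑-count-≥ n c)

∑-count-≡ : ∀ k c z → z < c + k → ∑[ j < k ] 𝟙[ c + toℕ j ≟ z ] ≡ 𝟙[ c ≤? z ]
∑-count-≡ (suc k) zero    zero    _ = cong suc (sum-replicate-zero k)
∑-count-≡ (suc k) zero    (suc z) z<k = ∑-count-≡ k zero z (s≤s⁻¹ z<k)
∑-count-≡ k       (suc c) zero    _ = sum-replicate-zero k
∑-count-≡ k       (suc c) (suc z) z<c+k =
  trans (∑-count-≡ k c z (s≤s⁻¹ z<c+k)) (sym (𝟙-≤?-suc c z))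

∑-toℕ : ∀ n → 2 * ∑[ i < n ] toℕ i + n ≡ n * n
∑-toℕ zero    = refl
∑-toℕ (suc n) = begin
  2 * ∑[ i < n ] suc (toℕ i) + suc n     ≡⟨ cong (λ s → 2 * s + suc n) (∑-suc {n} toℕ) ⟩
  2 * (n + S) + suc n                    ≡⟨ regroup n S ⟩
  (2 * S + n) + suc (n + n)              ≡⟨ cong (_+ suc (n + n)) (∑-toℕ n) ⟩
  n * n + suc (n + n)                    ≡⟨ square-suc n ⟩
  suc n * suc n                          ∎
  where
  open ≡-Reasoning
  S = ∑[ i < n ] toℕ i
  regroup : ∀ n S → 2 * (n + S) + suc n ≡ (2 * S + n) + suc (n + n)
  regroup = solve-∀
  square-suc : ∀ n → n * n + suc (n + n) ≡ suc n * suc n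
  square-suc = solve-∀

triangular : ∀ n → (∑[ i < n ] suc (toℕ i)) * 2 ≡ n * (n + 1)
triangular n = begin
  (∑[ i < n ] suc (toℕ i)) * 2           ≡⟨ cong (_* 2) (∑-suc {n} toℕ) ⟩
  (n + S) * 2                            ≡⟨ regroup n S ⟩
  (2 * S + n) + n                        ≡⟨ cong (_+ n) (∑-toℕ n) ⟩
  n * n + n                              ≡⟨ square+n n ⟩
  n * (n + 1)                            ∎
  where
  open ≡-Reasoning
  S = ∑[ i < n ] toℕ i
  regroup : ∀ n S → (n + S) * 2 ≡ (2 * S + n) + n
  regroup = solve-∀
  square+n : ∀ n → n * n + n ≡ n * (n + 1)
  square+n = solve-∀

degree-∑ : ∀ G u → degree G u ≡ ∑[ v < order G ] b2n (adj G u v)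
degree-∑ G u = sum-map-allFin (order G) (λ v → b2n (adj G u v))

module _ (G : SimpleGraph) where
  private
    V = order G
    a : Fin V → Fin V → ℕ
    a u v = b2n (adj G u v)
    below : Fin V → Fin V → ℕ
    below u v = 𝟙[ toℕ u <? toℕ v ] * a u v

  edgeCount-∑ : edgeCount G ≡ ∑[ u < V ] ∑[ v < V ] below u v
  edgeCount-∑ = trans (sum-map-allFin V (λ u → List.sum (map (below u) (allFin V))))
                      (sum-cong-≗ {V} (λ u → sum-map-allFin V (below u)))

  adjacency-split : ∀ u v → a u v ≡ below u v + below v u
  adjacency-split u v with <-cmp (toℕ u) (toℕ v)
  ... | tri< u<v _ v≮u rewrite 𝟙-yes (toℕ u <? toℕ v) u<v | 𝟙-no (toℕ v <? toℕ u) v≮u =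
    sym (trans (+-identityʳ _) (+-identityʳ _))
  ... | tri> u≮v _ v<u rewrite 𝟙-no (toℕ u <? toℕ v) u≮v | 𝟙-yes (toℕ v <? toℕ u) v<u =
    trans (cong b2n (SimpleGraph.sym G u v)) (sym (+-identityʳ _))
  ... | tri≈ _ u≡v _ rewrite toℕ-injective u≡v | irrefl G v =
    sym (cong₂ _+_ (*-zeroʳ 𝟙[ toℕ v <? toℕ v ]) (*-zeroʳ 𝟙[ toℕ v <? toℕ v ]))

  handshake : ∑[ u < V ] degree G u ≡ 2 * edgeCount G
  handshake = begin
    ∑[ u < V ] degree G u                                         ≡⟨ sum-cong-≗ {V} (degree-∑ G) ⟩
    ∑[ u < V ] ∑[ v < V ] a u v                                   ≡⟨ sum-cong-≗ {V} (λ u → sum-cong-≗ {V} (adjacency-split u)) ⟩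
    ∑[ u < V ] ∑[ v < V ] (below u v + below v u)                 ≡⟨ sum-cong-≗ {V} (λ u → ∑-distrib-+ (below u) (λ v → below v u)) ⟩
    ∑[ u < V ] (∑[ v < V ] below u v + ∑[ v < V ] below v u)      ≡⟨ ∑-distrib-+ (λ u → ∑[ v < V ] below u v) (λ u → ∑[ v < V ] below v u) ⟩
    E + ∑[ u < V ] ∑[ v < V ] below v u                           ≡⟨ cong (E +_) (sym (∑-comm below)) ⟩
    E + E                                                         ≡⟨ cong (E +_) (sym (+-identityʳ E)) ⟩
    2 * E                                                         ≡⟨ cong (2 *_) (sym edgeCount-∑) ⟩
    2 * edgeCount G                                               ∎
    where
    open ≡-Reasoning
    E = ∑[ u < V ] ∑[ v < V ] below u v

m≤1⇒m*m≡m : ∀ {m} → m ≤ 1 → m * m ≡ m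
m≤1⇒m*m≡m z≤n       = refl
m≤1⇒m*m≡m (s≤s z≤n) = refl

-- For a vertex set S with indicator s and K = |S|: a vertex of S has at most K − 1 neighbours in S,
-- and every edge from S to its complement is also counted by a degree outside S.
module _ (G : SimpleGraph) (s : Fin (order G) → ℕ) (s≤1 : ∀ u → s u ≤ 1) where
  private
    V = order G
    a : Fin V → Fin V → ℕ
    a u v = b2n (adj G u v)
    t : Fin V → ℕ
    t u = 1 ∸ s u
    K = sum s
    X Y : Fin V → ℕ
    X u = ∑[ v < V ] (s v * a u v)
    Y u = ∑[ v < V ] (t v * a u v)

    split-by-s : ∀ u c → c ≡ s u * c + t u * c
    split-by-s u c = begin
      c                   ≡⟨ sym (*-identityˡ c) ⟩
      1 * c               ≡⟨ cong (_* c) (sym (m+[n∸m]≡n (s≤1 u))) ⟩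
      (s u + t u) * c     ≡⟨ *-distribʳ-+ c (s u) (t u) ⟩
      s u * c + t u * c   ∎
      where open ≡-Reasoning

    degree≡X+Y : ∀ u → degree G u ≡ X u + Y u
    degree≡X+Y u = trans (degree-∑ G u)
      (trans (sum-cong-≗ {V} (λ v → split-by-s v (a u v)))
             (∑-distrib-+ (λ v → s v * a u v) (λ v → t v * a u v)))

    X+s≤K : ∀ u → X u + s u ≤ K
    X+s≤K u = begin
      X u + s u                                    ≡⟨ cong (X u +_) (sym (∑-pick u s)) ⟩
      X u + ∑[ v < V ] (𝟙[ u ≟ᶠ v ] * s v)          ≡⟨ sym (∑-distrib-+ (λ v → s v * a u v) (λ v → 𝟙[ u ≟ᶠ v ] * s v)) ⟩
      ∑[ v < V ] (s v * a u v + 𝟙[ u ≟ᶠ v ] * s v)  ≤⟨ ∑-mono-≤ term≤s ⟩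
      K                                            ∎
      where
      open ≤-Reasoning
      term≤s : ∀ v → s v * a u v + 𝟙[ u ≟ᶠ v ] * s v ≤ s v
      term≤s v with u ≟ᶠ v
      ... | yes refl rewrite irrefl G u = ≤-reflexive (cong₂ _+_ (*-zeroʳ (s u)) (+-identityʳ (s u)))
      ... | no _ = begin
        s v * a u v + 0  ≡⟨ +-identityʳ _ ⟩
        s v * a u v      ≤⟨ *-monoʳ-≤ (s v) (b2n≤1 (adj G u v)) ⟩
        s v * 1          ≡⟨ *-identityʳ (s v) ⟩
        s v              ∎

    inside : ∑[ u < V ] (s u * X u) + K ≤ K * K
    inside = begin
      ∑[ u < V ] (s u * X u) + K      ≡⟨ sym (∑-distrib-+ (λ u → s u * X u) s) ⟩
      ∑[ u < V ] (s u * X u + s u)    ≤⟨ ∑-mono-≤ term≤ ⟩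
      ∑[ u < V ] (s u * K)            ≡⟨ sym (*-distribʳ-sum K s) ⟩
      K * K                           ∎
      where
      open ≤-Reasoning
      term≤ : ∀ u → s u * X u + s u ≤ s u * K
      term≤ u = begin
        s u * X u + s u        ≡⟨ cong (s u * X u +_) (sym (m≤1⇒m*m≡m (s≤1 u))) ⟩
        s u * X u + s u * s u  ≡⟨ sym (*-distribˡ-+ (s u) (X u) (s u)) ⟩
        s u * (X u + s u)      ≤⟨ *-monoʳ-≤ (s u) (X+s≤K u) ⟩
        s u * K                ∎

    across : ∑[ u < V ] (s u * Y u) ≤ ∑[ v < V ] (t v * degree G v)
    across = begin
      ∑[ u < V ] (s u * Y u)                       ≡⟨ sum-cong-≗ {V} (λ u → *-distribˡ-sum (s u) (λ v → t v * a u v)) ⟩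
      ∑[ u < V ] ∑[ v < V ] (s u * (t v * a u v))  ≡⟨ ∑-comm (λ u v → s u * (t v * a u v)) ⟩
      ∑[ v < V ] ∑[ u < V ] (s u * (t v * a u v))  ≤⟨ ∑-mono-≤ (λ v → ∑-mono-≤ (term≤ v)) ⟩
      ∑[ v < V ] ∑[ u < V ] (t v * a v u)          ≡⟨ sum-cong-≗ {V} (λ v → sym (*-distribˡ-sum (t v) (a v))) ⟩
      ∑[ v < V ] (t v * ∑[ u < V ] a v u)          ≡⟨ sum-cong-≗ {V} (λ v → cong (t v *_) (sym (degree-∑ G v))) ⟩
      ∑[ v < V ] (t v * degree G v)                ∎
      where
      open ≤-Reasoning
      term≤ : ∀ v u → s u * (t v * a u v) ≤ t v * a v u
      term≤ v u = begin
        s u * (t v * a u v)  ≤⟨ *-monoˡ-≤ (t v * a u v) (s≤1 u) ⟩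
        1 * (t v * a u v)    ≡⟨ *-identityˡ _ ⟩
        t v * a u v          ≡⟨ cong (λ b → t v * b2n b) (SimpleGraph.sym G u v) ⟩
        t v * a v u          ∎

  subset-degree-bound : 2 * ∑[ u < V ] (s u * degree G u) + K ≤ 2 * edgeCount G + K * K
  subset-degree-bound = begin
    2 * P + K                          ≡⟨ double P K ⟩
    P + (P + K)                        ≡⟨ cong (λ p → P + (p + K)) P≡inX+inY ⟩
    P + ((inX + inY) + K)              ≡⟨ cong (P +_) (trans (+-assoc inX inY K) (swap-last inX inY K)) ⟩
    P + ((inX + K) + inY)              ≤⟨ +-monoʳ-≤ P (+-mono-≤ inside across) ⟩
    P + (K * K + T)                    ≡⟨ swap-last P (K * K) T ⟩
    (P + T) + K * K                    ≡⟨ cong (_+ K * K) (sym total≡P+T) ⟩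
    ∑[ u < V ] degree G u + K * K      ≡⟨ cong (_+ K * K) (handshake G) ⟩
    2 * edgeCount G + K * K            ∎
    where
    open ≤-Reasoning
    P = ∑[ u < V ] (s u * degree G u)
    T = ∑[ u < V ] (t u * degree G u)
    inX = ∑[ u < V ] (s u * X u)
    inY = ∑[ u < V ] (s u * Y u)
    double : ∀ p k → 2 * p + k ≡ p + (p + k)
    double = solve-∀
    swap-last : ∀ x y z → x + (y + z) ≡ (x + z) + y
    swap-last = solve-∀
    P≡inX+inY : P ≡ inX + inY
    P≡inX+inY = trans (sum-cong-≗ {V} (λ u → trans (cong (s u *_) (degree≡X+Y u)) (*-distribˡ-+ (s u) (X u) (Y u))))
                      (∑-distrib-+ (λ u → s u * X u) (λ u → s u * Y u))
    total≡P+T : ∑[ u < V ] degree G u ≡ P + T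
    total≡P+T = trans (sum-cong-≗ {V} (λ u → split-by-s u (degree G u)))
                      (∑-distrib-+ (λ u → s u * degree G u) (λ u → t u * degree G u))

module _ {N k : ℕ} (w : Fin k → Fin N) where

  multiplicity : Fin N → ℕ
  multiplicity u = ∑[ j < k ] 𝟙[ w j ≟ᶠ u ]

  ∑-multiplicity : ∀ f → ∑[ u < N ] (multiplicity u * f u) ≡ ∑[ j < k ] f (w j)
  ∑-multiplicity f = begin
    ∑[ u < N ] (multiplicity u * f u)              ≡⟨ sum-cong-≗ {N} (λ u → *-distribʳ-sum (f u) (λ j → 𝟙[ w j ≟ᶠ u ])) ⟩
    ∑[ u < N ] ∑[ j < k ] (𝟙[ w j ≟ᶠ u ] * f u)    ≡⟨ ∑-comm (λ u j → 𝟙[ w j ≟ᶠ u ] * f u) ⟩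
    ∑[ j < k ] ∑[ u < N ] (𝟙[ w j ≟ᶠ u ] * f u)    ≡⟨ sum-cong-≗ {k} (λ j → ∑-pick (w j) f) ⟩
    ∑[ j < k ] f (w j)                             ∎
    where open ≡-Reasoning

  sum-multiplicity : sum multiplicity ≡ k
  sum-multiplicity = begin
    sum multiplicity                     ≡⟨ sum-cong-≗ {N} (λ u → sym (*-identityʳ (multiplicity u))) ⟩
    ∑[ u < N ] (multiplicity u * 1)      ≡⟨ ∑-multiplicity (λ _ → 1) ⟩
    ∑[ j < k ] 1                         ≡⟨ ∑-const k 1 ⟩
    k * 1                                ≡⟨ *-identityʳ k ⟩
    k                                    ∎
    where open ≡-Reasoning

multiplicity-≤1 : ∀ {N k} (w : Fin k → Fin N) → Injective _≡_ _≡_ w → ∀ u → multiplicity w u ≤ 1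
multiplicity-≤1 {k = zero}  w w-inj u = z≤n
multiplicity-≤1 {k = suc k} w w-inj u with w zero ≟ᶠ u
... | yes refl = ≤-reflexive (cong suc (trans (sum-cong-≗ {k} (λ j → 𝟙-no (w (suc j) ≟ᶠ w zero) (suc≢zero ∘ w-inj)))
                                                (sum-replicate-zero k)))
  where
  suc≢zero : ∀ {j : Fin k} → ¬ suc j ≡ zero
  suc≢zero ()
... | no _ = multiplicity-≤1 (w ∘ suc) (Finₚ.suc-injective ∘ w-inj) u

∑-consecutive : ∀ k h → 2 * ∑[ j < k ] (h + toℕ j) + k ≡ 2 * (k * h) + k * k
∑-consecutive k h = begin
  2 * ∑[ j < k ] (h + toℕ j) + k   ≡⟨ cong (λ x → 2 * x + k) (∑-distrib-+ {k} (λ _ → h) toℕ) ⟩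
  2 * (∑[ j < k ] h + S) + k       ≡⟨ cong (λ x → 2 * (x + S) + k) (∑-const k h) ⟩
  2 * (k * h + S) + k              ≡⟨ regroup (k * h) S k ⟩
  2 * (k * h) + (2 * S + k)        ≡⟨ cong (2 * (k * h) +_) (∑-toℕ k) ⟩
  2 * (k * h) + k * k              ∎
  where
  open ≡-Reasoning
  S = ∑[ j < k ] toℕ j
  regroup : ∀ x S k → 2 * (x + S) + k ≡ 2 * x + (2 * S + k)
  regroup = solve-∀

edgeCount-≥ : ∀ (G : SimpleGraph) {k} h (w : Fin k → Fin (order G)) →
              (∀ j → degree G (w j) ≡ h + toℕ j) → k * h ≤ edgeCount G
edgeCount-≥ G {k} h w degree-w = *-cancelˡ-≤ 2 (+-cancelʳ-≤ (k * k) (2 * (k * h)) (2 * edgeCount G) (begin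
  2 * (k * h) + k * k                                    ≡⟨ sym (∑-consecutive k h) ⟩
  2 * ∑[ j < k ] (h + toℕ j) + k                         ≡⟨ cong₂ (λ x y → 2 * x + y) (sym P≡) (sym (sum-multiplicity w)) ⟩
  2 * ∑[ u < V ] (s u * degree G u) + sum s              ≤⟨ subset-degree-bound G s (multiplicity-≤1 w w-injective) ⟩
  2 * edgeCount G + sum s * sum s                        ≡⟨ cong (λ x → 2 * edgeCount G + x * x) (sum-multiplicity w) ⟩
  2 * edgeCount G + k * k                                ∎))
  where
  open ≤-Reasoning
  V = order G
  s = multiplicity w
  P≡ : ∑[ u < V ] (s u * degree G u) ≡ ∑[ j < k ] (h + toℕ j)
  P≡ = trans (∑-multiplicity w (degree G)) (sum-cong-≗ {k} degree-w)
  w-injective : Injective _≡_ _≡_ w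
  w-injective {i} {j} wi≡wj =
    toℕ-injective (+-cancelˡ-≡ h (toℕ i) (toℕ j) (trans (sym (degree-w i)) (trans (cong (degree G) wi≡wj) (degree-w j))))

edgeCount-≥-degreeSet : ∀ m k (G : SimpleGraph) → HasDegreeSet1to (m + k) G → k * suc m ≤ edgeCount G
edgeCount-≥-degreeSet m k G (_ , attained) = edgeCount-≥ G (suc m) w (λ j → proj₂ (vertex j))
  where
  vertex : ∀ (j : Fin k) → ∃ λ v → degree G v ≡ suc m + toℕ j
  vertex j = attained (suc m + toℕ j) (s≤s z≤n)
                      (≤-trans (≤-reflexive (sym (+-suc m (toℕ j)))) (+-monoʳ-≤ m (toℕ<n j)))
  w : Fin k → Fin (order G)
  w j = proj₁ (vertex j)

module _ {N : ℕ} {R : Fin N → Fin N → Set} (R? : Decidable R) (R-sym : Symmetric R) (R-irrefl : ∀ u → ¬ R u u) where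

  graphOf : SimpleGraph
  graphOf = record
    { order  = N
    ; adj    = λ u v → does (R? u v)
    ; sym    = λ u v → does-⇔ (mk⇔ R-sym R-sym) (R? u v) (R? v u)
    ; irrefl = λ u → dec-false (R? u u) (R-irrefl u)
    }

-- Balanced m k says that m = ⌊ n/2 ⌋ and k = ⌈ n/2 ⌉ for n = m + k.
data Balanced : ℕ → ℕ → Set where
  even : ∀ {m} → Balanced m m
  odd  : ∀ {m} → Balanced m (suc m)

balanced-split : ∀ n → ∃₂ λ m k → Balanced m k × m + k ≡ n
balanced-split zero = 0 , 0 , even , refl
balanced-split (suc n) with balanced-split n
... | m , .m       , even , refl = m , suc m , odd , +-suc m m
... | m , .(suc m) , odd  , refl = suc m , suc m , even , refl

double-≤-suc⇒≤ : ∀ {m x} → m + m ≤ suc (x + x) → m ≤ x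
double-≤-suc⇒≤ {m} {x} le with m ≤? x
... | yes m≤x = m≤x
... | no  m≰x = contradiction le (<⇒≱ (begin-strict
  suc (x + x)        <⟨ n<1+n _ ⟩
  suc (suc (x + x))  ≡⟨ cong suc (sym (+-suc x x)) ⟩
  suc x + suc x      ≤⟨ +-mono-≤ (≰⇒> m≰x) (≰⇒> m≰x) ⟩
  m + m              ∎))
  where open ≤-Reasoning

balanced-threshold : ∀ {m k} → Balanced m k → ∀ x → m ≤ x ⇔ m + k ≤ suc (x + x)
balanced-threshold even x = mk⇔ (λ m≤x → m≤n⇒m≤1+n (+-mono-≤ m≤x m≤x)) double-≤-suc⇒≤
balanced-threshold {m} odd x = mk⇔
  (λ m≤x → subst (_≤ suc (x + x)) (sym (+-suc m m)) (s≤s (+-mono-≤ m≤x m≤x)))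
  (λ le → double-≤-suc⇒≤ (m≤n⇒m≤1+n (s≤s⁻¹ (subst (_≤ suc (x + x)) (+-suc m m) le))))

-- inj₁ x is the branch vertex x and inj₂ j the pendant vertex hanging on branch vertex m + j.
module Construction (m k : ℕ) where

  n : ℕ
  n = m + k

  Linked : Fin n ⊎ Fin k → Fin n ⊎ Fin k → Set
  Linked (inj₁ x) (inj₁ y) = x ≢ y × n ≤ suc (toℕ x + toℕ y)
  Linked (inj₁ x) (inj₂ j) = m + toℕ j ≡ toℕ x
  Linked (inj₂ j) (inj₁ y) = toℕ y ≡ m + toℕ j
  Linked (inj₂ _) (inj₂ _) = ⊥

  linked? : Decidable Linked
  linked? (inj₁ x) (inj₁ y) = ¬? (x ≟ᶠ y) ×-dec (n ≤? suc (toℕ x + toℕ y))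
  linked? (inj₁ x) (inj₂ j) = m + toℕ j ≟ toℕ x
  linked? (inj₂ j) (inj₁ y) = toℕ y ≟ m + toℕ j
  linked? (inj₂ _) (inj₂ _) = no λ ()

  Linked-sym : Symmetric Linked
  Linked-sym {inj₁ x} {inj₁ y} (x≢y , le) = ≢-sym x≢y , subst (λ z → n ≤ suc z) (+-comm (toℕ x) (toℕ y)) le
  Linked-sym {inj₁ x} {inj₂ j} e = sym e
  Linked-sym {inj₂ j} {inj₁ y} e = sym e

  Linked-irrefl : ∀ p → ¬ Linked p p
  Linked-irrefl (inj₁ x) (x≢x , _) = x≢x refl

  graph : SimpleGraph
  graph = graphOf (λ u v → linked? (splitAt n u) (splitAt n v)) Linked-sym (Linked-irrefl ∘ splitAt n)

  degreeOf : Fin n ⊎ Fin k → ℕ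
  degreeOf p = ∑[ y < n ] 𝟙[ linked? p (inj₁ y) ] + ∑[ j < k ] 𝟙[ linked? p (inj₂ j) ]

  degree-graph : ∀ v → degree graph v ≡ degreeOf (splitAt n v)
  degree-graph v = trans (degree-∑ graph v) (∑-splitAt n k (λ q → 𝟙[ linked? (splitAt n v) q ]))

  degreeOf-leaf : ∀ j → degreeOf (inj₂ j) ≡ 1
  degreeOf-leaf j = cong₂ _+_ (∑-count-≡ n 0 (m + toℕ j) (+-monoʳ-< m (toℕ<n j))) (sum-replicate-zero k)

  degreeOf-branch : Balanced m k → ∀ x → degreeOf (inj₁ x) ≡ suc (toℕ x)
  degreeOf-branch b x = begin
    ∑[ y < n ] 𝟙[ ¬? (x ≟ᶠ y) ×-dec Q? y ] + ∑[ j < k ] 𝟙[ m + toℕ j ≟ toℕ x ]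
      ≡⟨ cong (∑[ y < n ] 𝟙[ ¬? (x ≟ᶠ y) ×-dec Q? y ] +_) leaves ⟩
    ∑[ y < n ] 𝟙[ ¬? (x ≟ᶠ y) ×-dec Q? y ] + 𝟙[ Q? x ]
      ≡⟨ ∑-except x Q? ⟩
    ∑[ y < n ] 𝟙[ Q? y ]
      ≡⟨ sum-cong-≗ {n} (λ y → cong b2n (does-⇔ (shift y) (Q? y) (n ∸ suc (toℕ x) ≤? toℕ y))) ⟩
    ∑[ y < n ] 𝟙[ n ∸ suc (toℕ x) ≤? toℕ y ]
      ≡⟨ ∑-count-≥ n (n ∸ suc (toℕ x)) ⟩
    n ∸ (n ∸ suc (toℕ x))
      ≡⟨ m∸[m∸n]≡n (toℕ<n x) ⟩
    suc (toℕ x) ∎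
    where
    open ≡-Reasoning
    Q? : ∀ y → Dec (n ≤ suc (toℕ x + toℕ y))
    Q? y = n ≤? suc (toℕ x + toℕ y)
    leaves : ∑[ j < k ] 𝟙[ m + toℕ j ≟ toℕ x ] ≡ 𝟙[ Q? x ]
    leaves = trans (∑-count-≡ k m (toℕ x) (toℕ<n x))
                   (cong b2n (does-⇔ (balanced-threshold b (toℕ x)) (m ≤? toℕ x) (Q? x)))
    shift : ∀ y → n ≤ suc (toℕ x) + toℕ y ⇔ n ∸ suc (toℕ x) ≤ toℕ y
    shift y = mk⇔ (m≤n+o⇒m∸n≤o n (suc (toℕ x)))
                  (λ le → ≤-trans (m≤n+m∸n n (suc (toℕ x))) (+-monoʳ-≤ (suc (toℕ x)) le))

  hasDegreeSet : Balanced m k → 1 ≤ n → HasDegreeSet1to n graph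
  hasDegreeSet b 1≤n = bounds , attained
    where
    degreeOf-bounds : ∀ p → 1 ≤ degreeOf p × degreeOf p ≤ n
    degreeOf-bounds (inj₁ x) rewrite degreeOf-branch b x = s≤s z≤n , toℕ<n x
    degreeOf-bounds (inj₂ j) rewrite degreeOf-leaf j = ≤-refl , 1≤n
    bounds : ∀ v → 1 ≤ degree graph v × degree graph v ≤ n
    bounds v = subst (λ d → 1 ≤ d × d ≤ n) (sym (degree-graph v)) (degreeOf-bounds (splitAt n v))
    attained : ∀ d → 1 ≤ d → d ≤ n → ∃ λ v → degree graph v ≡ d
    attained (suc d) _ d<n = x ↑ˡ k , (begin
      degree graph (x ↑ˡ k)        ≡⟨ degree-graph (x ↑ˡ k) ⟩
      degreeOf (splitAt n (x ↑ˡ k)) ≡⟨ cong degreeOf (splitAt-↑ˡ n x k) ⟩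
      degreeOf (inj₁ x)            ≡⟨ degreeOf-branch b x ⟩
      suc (toℕ x)                  ≡⟨ cong suc (toℕ-fromℕ< d<n) ⟩
      suc d                        ∎)
      where
      open ≡-Reasoning
      x = fromℕ< d<n

  twice-edgeCount : Balanced m k → 2 * edgeCount graph ≡ ∑[ x < n ] suc (toℕ x) + k
  twice-edgeCount b = begin
    2 * edgeCount graph                                    ≡⟨ sym (handshake graph) ⟩
    ∑[ v < n + k ] degree graph v                          ≡⟨ sum-cong-≗ {n + k} degree-graph ⟩
    ∑[ v < n + k ] degreeOf (splitAt n v)                  ≡⟨ ∑-splitAt n k degreeOf ⟩
    ∑[ x < n ] degreeOf (inj₁ x) + ∑[ j < k ] degreeOf (inj₂ j)
      ≡⟨ cong₂ _+_ (sum-cong-≗ {n} (degreeOf-branch b)) (trans (sum-cong-≗ {k} degreeOf-leaf) (trans (∑-const k 1) (*-identityʳ k))) ⟩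
    ∑[ x < n ] suc (toℕ x) + k                             ∎
    where open ≡-Reasoning

balanced-identity : ∀ {m k} → Balanced m k → (m + k) * (m + k + 1) + 2 * k ≡ 2 * (2 * (k * suc m))
balanced-identity {m} even = identity m
  where
  identity : ∀ m → (m + m) * (m + m + 1) + 2 * m ≡ 2 * (2 * (m * suc m))
  identity = solve-∀
balanced-identity {m} odd = identity m
  where
  identity : ∀ m → (m + suc m) * (m + suc m + 1) + 2 * suc m ≡ 2 * (2 * (suc m * suc m))
  identity = solve-∀

balanced-sum : ∀ {m k} → Balanced m k → ∑[ x < m + k ] suc (toℕ x) + k ≡ 2 * (k * suc m)
balanced-sum {m} {k} b = *-cancelˡ-≡ (T + k) (2 * (k * suc m)) 2 (begin
  2 * (T + k)                        ≡⟨ regroup T k ⟩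
  T * 2 + 2 * k                      ≡⟨ cong (_+ 2 * k) (triangular (m + k)) ⟩
  (m + k) * (m + k + 1) + 2 * k      ≡⟨ balanced-identity b ⟩
  2 * (2 * (k * suc m))              ∎)
  where
  open ≡-Reasoning
  T = ∑[ x < m + k ] suc (toℕ x)
  regroup : ∀ T k → 2 * (T + k) ≡ T * 2 + 2 * k
  regroup = solve-∀

half-double : ∀ a → (2 * a) / 2 ≡ a
half-double a = trans (cong (_/ 2) (*-comm 2 a)) (m*n/n≡m a 2)

half-double-suc : ∀ a → (a + a + 1) / 2 ≡ a
half-double-suc a = begin
  (a + a + 1) / 2        ≡⟨ cong (_/ 2) (twice a) ⟩
  (a * 2 + 1) / 2        ≡⟨ +-distrib-/-∣ˡ 1 (n∣m*n a) ⟩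
  a * 2 / 2 + 1 / 2      ≡⟨ cong (_+ 0) (m*n/n≡m a 2) ⟩
  a + 0                  ≡⟨ +-identityʳ a ⟩
  a                      ∎
  where
  open ≡-Reasoning
  twice : ∀ a → a + a + 1 ≡ a * 2 + 1
  twice = solve-∀

ceilHalf-balanced : ∀ {m k} → Balanced m k → ceilHalf (m + k) ≡ k
ceilHalf-balanced {m} even = half-double-suc m
ceilHalf-balanced {m} odd  = trans (cong (_/ 2) (double-suc m)) (half-double (suc m))
  where
  double-suc : ∀ m → m + suc m + 1 ≡ 2 * suc m
  double-suc = solve-∀

lq-value : ∀ {m k} → Balanced m k → (((m + k) * ((m + k) + 1)) / 2 + ceilHalf (m + k)) / 2 ≡ k * suc m
lq-value {m} {k} b = begin
  ((n * (n + 1)) / 2 + ceilHalf n) / 2   ≡⟨ cong₂ (λ x y → (x + y) / 2) half-triangle (ceilHalf-balanced b) ⟩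
  (T + k) / 2                            ≡⟨ cong (_/ 2) (balanced-sum b) ⟩
  (2 * (k * suc m)) / 2                  ≡⟨ half-double (k * suc m) ⟩
  k * suc m                              ∎
  where
  open ≡-Reasoning
  n = m + k
  T = ∑[ x < n ] suc (toℕ x)
  half-triangle : (n * (n + 1)) / 2 ≡ T
  half-triangle = trans (cong (_/ 2) (sym (triangular n))) (m*n/n≡m T 2)

isLq-balanced : ∀ {m k} → Balanced m k → 1 ≤ m + k → IsLq1to (m + k) (k * suc m)
isLq-balanced {m} {k} b 1≤n = (graph , hasDegreeSet b 1≤n , edges) , edgeCount-≥-degreeSet m k
  where
  open Construction m k
  edges : edgeCount graph ≡ k * suc m
  edges = *-cancelˡ-≡ (edgeCount graph) (k * suc m) 2 (trans (twice-edgeCount b) (balanced-sum b))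

theorem6 : ∀ (n : ℕ) → 1 ≤ n → IsLq1to n (((n * (n + 1)) / 2 + ceilHalf n) / 2)
theorem6 n 1≤n with balanced-split n
... | m , k , b , refl = subst (IsLq1to (m + k)) (sym (lq-value b)) (isLq-balanced b 1≤n)
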